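{- Let $\mathbf{u}$ be an infinite $\Theta$-rich word. Then for every factor $w$ of $\mathbf{u}$ with $w\neq\Theta(w)$, the occurrences of $w$ and $\Theta(w)$ in $\mathbf{u}$ alternate.
   Context: $\Theta$ is an involutory antimorphism of $\mathcal{A}^*$ over a finite alphabet $\mathcal{A}$ ($\Theta^2=\mathrm{id}$, $\Theta(vw)=\Theta(w)\Theta(v)$); a word $v$ is a $\Theta$-palindrome if $\Theta(v)=v$. For a finite word $w$, $\gamma(w)=\{\{a,\Theta(a)\}: a\in\mathcal{A},\ a\neq\Theta(a),\ a\text{ or }\Theta(a)\text{ occurs in } w\}$. A finite word $w$ is $\Theta$-rich if it has exactly $|w|+1-\#\gamma(w)$ distinct $\Theta$-palindromic factors (empty word included); an infinite word is $\Theta$-rich if all its finite factors are. Occurrences of $w$ and $\Theta(w)$ alternate if there is no factor $v$ of $\mathbf{u}$ with $|v|>|w|$ having $w$ as both prefix and suffix and not containing $\Theta(w)$, and likewise with the roles of $w$ and $\Theta(w)$ exchanged. -}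

module Defs where

open import Data.Nat using (ℕ; zero; suc; _+_; _∸_; _<_)
open import Data.Fin using (Fin)
open import Data.Fin.Properties using () renaming (_≟_ to _≟F_)
open import Data.List using (List; []; _∷_; _++_; length; take; drop; map; concatMap; upTo; filter; deduplicate; allFin)
open import Data.List.Properties using (≡-dec)
open import Data.List.Relation.Unary.Any using (any?)
open import Data.Product using (Σ; ∃; _×_; _,_)
open import Data.Sum using (_⊎_)
open import Relation.Nullary using (¬_; Dec; ¬?; _×-dec_; _⊎-dec_)
open import Relation.Binary.PropositionalEquality using (_≡_)

Word : ℕ → Set
Word k = List (Fin k)

_≟W_ : ∀ {k} (v w : Word k) → Dec (v ≡ w)
_≟W_ = ≡-dec _≟F_

record InvAntimorphism (k : ℕ) : Set where
  field
    Θ       : Word k → Word k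
    anti    : ∀ v w → Θ (v ++ w) ≡ Θ w ++ Θ v
    involut : ∀ v → Θ (Θ v) ≡ v
open InvAntimorphism public

IsPal : ∀ {k} → InvAntimorphism k → Word k → Set
IsPal T v = Θ T v ≡ v

isPal? : ∀ {k} (T : InvAntimorphism k) (v : Word k) → Dec (IsPal T v)
isPal? T v = Θ T v ≟W v

allFactors : ∀ {k} → Word k → List (Word k)
allFactors w =
  concatMap (λ i → map (λ j → take j (drop i w)) (upTo (suc (length w ∸ i))))
            (upTo (suc (length w)))

occurs? : ∀ {k} (x w : Word k) → Dec (Data.List.Relation.Unary.Any.Any (x ≡_) (allFactors w))
occurs? x w = any? (x ≟W_) (allFactors w)

-- number of distinct Θ-palindromic factors of w (empty word included)
numPalFactors : ∀ {k} → InvAntimorphism k → Word k → ℕ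
numPalFactors T w = length (deduplicate _≟W_ (filter (isPal? T) (allFactors w)))

-- A pair {a, Θ(a)} is represented by (a ∷ [] , Θ (a ∷ [])); two representatives
-- denote the same unordered pair iff they agree up to swapping.
SamePair : ∀ {k} → (Word k × Word k) → (Word k × Word k) → Set
SamePair (x , y) (x' , y') = (x ≡ x' × y ≡ y') ⊎ (x ≡ y' × y ≡ x')

samePair? : ∀ {k} (p q : Word k × Word k) → Dec (SamePair p q)
samePair? (x , y) (x' , y') = ((x ≟W x') ×-dec (y ≟W y')) ⊎-dec ((x ≟W y') ×-dec (y ≟W x'))

gammaList : ∀ {k} → InvAntimorphism k → Word k → List (Word k × Word k)
gammaList {k} T w =
  deduplicate samePair?
    (map (λ a → (a ∷ [] , Θ T (a ∷ [])))
      (filter (λ a → ¬? ((a ∷ []) ≟W Θ T (a ∷ []))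
                     ×-dec (occurs? (a ∷ []) w ⊎-dec occurs? (Θ T (a ∷ [])) w))
              (allFin k)))

#γ : ∀ {k} → InvAntimorphism k → Word k → ℕ
#γ T w = length (gammaList T w)

RichFin : ∀ {k} → InvAntimorphism k → Word k → Set
RichFin T w = numPalFactors T w ≡ suc (length w) ∸ #γ T w

InfWord : ℕ → Set
InfWord k = ℕ → Fin k

factorAt : ∀ {k} → InfWord k → ℕ → ℕ → Word k
factorAt u i zero    = []
factorAt u i (suc n) = u i ∷ factorAt u (suc i) n

Factor : ∀ {k} → Word k → InfWord k → Set
Factor w u = ∃ λ i → factorAt u i (length w) ≡ w

Rich : ∀ {k} → InvAntimorphism k → InfWord k → Set
Rich T u = ∀ i n → RichFin T (factorAt u i n)

Prefix Suffix Infix : ∀ {k} → Word k → Word k → Set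
Prefix w v = ∃ λ s → w ++ s ≡ v
Suffix w v = ∃ λ p → p ++ w ≡ v
Infix  w v = ∃ λ p → ∃ λ s → p ++ w ++ s ≡ v

BadFactor : ∀ {k} → InfWord k → Word k → Word k → Set
BadFactor u w x = ∃ λ v → Factor v u × length w < length v × Prefix w v × Suffix w v × ¬ Infix x v

Alternate : ∀ {k} → InvAntimorphism k → InfWord k → Word k → Set
Alternate T u w = ¬ BadFactor u w (Θ T w) × ¬ BadFactor u (Θ T w) w

module Submission where

open import Defs
open import Data.Nat using (ℕ; zero; suc; _+_; _∸_; _<_; _≤_; z≤n; s≤s)
open import Data.Nat.Properties
  using (+-identityʳ; +-suc; +-comm; +-mono-≤; ≤-antisym; <-irrefl; <⇒≤; 1+n≢n; n>0⇒n≢0; m∸n≢0⇒n<m; +-∸-assoc; m+n∸m≡n; module ≤-Reasoning)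
open import Data.Fin using (Fin)
open import Data.List using (List; []; _∷_; _++_; _∷ʳ_; [_]; length; take; drop; map; upTo; filter; deduplicate; allFin; initLast; _∷ʳ′_)
open import Data.List.Properties
  using (++-assoc; ++-identityʳ; ++-cancelˡ; ++-conicalʳ; ∷ʳ-injective; ∷-injectiveʳ; length-++; length-++-≤ˡ; length-++-comm; take++drop≡id; filter-≐)
open import Data.List.Membership.Propositional using (_∈_; lose)
open import Data.List.Membership.Propositional.Properties
  using (∈-concatMap⁺; ∈-concatMap⁻; ∈-upTo⁺; ∈-filter⁺; ∈-filter⁻; deduplicate-∈⇔; ∈-map⁺; ∈-map⁻)
open import Data.List.Membership.Propositional.Properties.WithK using (unique∧set⇒bag)
open import Data.List.Relation.Binary.BagAndSetEquality using (∼bag⇒↭)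
open import Data.List.Relation.Binary.Permutation.Propositional.Properties using (↭-length)
open import Data.List.Relation.Unary.Unique.DecPropositional.Properties using (deduplicate-!)
open import Data.List.Relation.Unary.Any using (here; there; satisfied)
open import Data.Product using (_,_; proj₁)
import Data.Product as Product
open import Data.Sum using (_⊎_; inj₁; inj₂)
import Data.Sum as Sum
open import Data.Empty using (⊥; ⊥-elim)
open import Function.Bundles using (mk⇔; Equivalence)
open import Relation.Binary.Definitions using (DecidableEquality)
open import Relation.Nullary using (¬_)
open import Relation.Binary.PropositionalEquality using (_≡_; _≢_; refl; sym; trans; cong; cong₂; subst; module ≡-Reasoning)

-- A factor v ∷ʳ a of u that starts and ends with w and avoids Θ(w) has the
-- same Θ-palindromic factors as v: a palindrome ending at the last position
-- and longer than w would start with Θ(w), and a shorter one already lies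
-- inside the occurrence of w at the start.  Likewise the last letter a
-- already occurs in v, so γ does not grow either.  Then richness of both v
-- and v ∷ʳ a forces |v| + 1 − #γ = |v| + 2 − #γ, which is absurd.

module _ {A : Set} where

  length-deduplicate-cong : (_≟_ : DecidableEquality A) {xs ys : List A} →
    (∀ {x} → x ∈ xs → x ∈ ys) → (∀ {x} → x ∈ ys → x ∈ xs) →
    length (deduplicate _≟_ xs) ≡ length (deduplicate _≟_ ys)
  length-deduplicate-cong _≟_ {xs} {ys} xs⊆ys ys⊆xs =
    ↭-length (∼bag⇒↭ (unique∧set⇒bag (deduplicate-! _≟_ xs) (deduplicate-! _≟_ ys)
      (mk⇔ (λ m → dedup⁺ (xs⊆ys (dedup⁻ m))) (λ m → dedup⁺ (ys⊆xs (dedup⁻ m))))))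
    where
    dedup⁺ : ∀ {zs x} → x ∈ zs → x ∈ deduplicate _≟_ zs
    dedup⁺ = Equivalence.to (deduplicate-∈⇔ _≟_)
    dedup⁻ : ∀ {zs x} → x ∈ deduplicate _≟_ zs → x ∈ zs
    dedup⁻ = Equivalence.from (deduplicate-∈⇔ _≟_)

  ∈⇒1≤length : {x : A} {xs : List A} → x ∈ xs → 1 ≤ length xs
  ∈⇒1≤length (here _)  = s≤s z≤n
  ∈⇒1≤length (there _) = s≤s z≤n

  drop-length-++ : (xs ys : List A) → drop (length xs) (xs ++ ys) ≡ ys
  drop-length-++ []       ys = refl
  drop-length-++ (x ∷ xs) ys = drop-length-++ xs ys

  take-length-++ : (xs ys : List A) → take (length xs) (xs ++ ys) ≡ xs
  take-length-++ []       ys = refl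
  take-length-++ (x ∷ xs) ys = cong (x ∷_) (take-length-++ xs ys)

module _ {k : ℕ} where

  Infix-trans : {x y z : Word k} → Infix x y → Infix y z → Infix x z
  Infix-trans {x} (p , s , refl) (q , t , refl) = q ++ p , s ++ t , reassoc
    where
    open ≡-Reasoning
    reassoc : (q ++ p) ++ x ++ s ++ t ≡ q ++ (p ++ x ++ s) ++ t
    reassoc = begin
      (q ++ p) ++ x ++ s ++ t   ≡⟨ ++-assoc q p _ ⟩
      q ++ p ++ x ++ s ++ t     ≡⟨ cong (λ r → q ++ p ++ r) (sym (++-assoc x s t)) ⟩
      q ++ p ++ (x ++ s) ++ t   ≡⟨ cong (q ++_) (sym (++-assoc p (x ++ s) t)) ⟩
      q ++ (p ++ x ++ s) ++ t   ∎

  Prefix⇒Infix : {x y : Word k} → Prefix x y → Infix x y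
  Prefix⇒Infix (s , e) = [] , s , e

  Suffix⇒Infix : {x y : Word k} → Suffix x y → Infix x y
  Suffix⇒Infix {x} (p , e) = p , [] , trans (cong (p ++_) (++-identityʳ x)) e

  Infix-take-drop : (i j : ℕ) (w : Word k) → Infix (take j (drop i w)) w
  Infix-take-drop i j w = take i w , drop j (drop i w) ,
    trans (cong (take i w ++_) (take++drop≡id j (drop i w))) (take++drop≡id i w)

  factorsFrom : Word k → ℕ → List (Word k)
  factorsFrom w i = map (λ j → take j (drop i w)) (upTo (suc (length w ∸ i)))

  ∈-allFactors⇒Infix : {x w : Word k} → x ∈ allFactors w → Infix x w
  ∈-allFactors⇒Infix {x} {w} x∈ with satisfied (∈-concatMap⁻ (factorsFrom w) {xs = upTo (suc (length w))} x∈)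
  ... | i , x∈row with ∈-map⁻ (λ j → take j (drop i w)) {xs = upTo (suc (length w ∸ i))} x∈row
  ... | j , _ , refl = Infix-take-drop i j w

  Infix⇒∈-allFactors : {x w : Word k} → Infix x w → x ∈ allFactors w
  Infix⇒∈-allFactors {x} (p , s , refl) =
    ∈-concatMap⁺ (factorsFrom w) (lose (∈-upTo⁺ (s≤s (length-++-≤ˡ p))) x∈row)
    where
    w = p ++ x ++ s
    row : List (Word k)
    row = factorsFrom w (length p)
    |x|≤ : length x ≤ length w ∸ length p
    |x|≤ = subst (length x ≤_)
      (sym (trans (cong (_∸ length p) (length-++ p)) (m+n∸m≡n (length p) (length (x ++ s)))))
      (length-++-≤ˡ x)
    x-at-|p| : take (length x) (drop (length p) w) ≡ x
    x-at-|p| = trans (cong (take (length x)) (drop-length-++ p (x ++ s))) (take-length-++ x s)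
    x∈row : x ∈ row
    x∈row = subst (_∈ row) x-at-|p| (∈-map⁺ _ (∈-upTo⁺ (s≤s |x|≤)))

  Infix-∷ʳ : {y v : Word k} {a : Fin k} → Infix y (v ∷ʳ a) → Infix y v ⊎ Suffix y (v ∷ʳ a)
  Infix-∷ʳ {y} (p , s , e) with initLast s
  ... | [] = inj₂ (p , trans (cong (p ++_) (sym (++-identityʳ y))) e)
  ... | s′ ∷ʳ′ c = inj₁ (p , s′ , proj₁ (∷ʳ-injective (p ++ y ++ s′) _ (trans reassoc e)))
    where
    reassoc : (p ++ y ++ s′) ++ [ c ] ≡ p ++ y ++ s′ ++ [ c ]
    reassoc = trans (++-assoc p (y ++ s′) [ c ]) (cong (p ++_) (++-assoc y s′ [ c ]))

  Prefix-∷ʳ : {w v : Word k} {a : Fin k} → length w < length (v ∷ʳ a) → Prefix w (v ∷ʳ a) → Prefix w v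
  Prefix-∷ʳ {w} lt (s , e) with initLast s
  ... | [] = ⊥-elim (<-irrefl (cong length (trans (sym (++-identityʳ w)) e)) lt)
  ... | s′ ∷ʳ′ c = s′ , proj₁ (∷ʳ-injective (w ++ s′) _ (trans (++-assoc w s′ [ c ]) e))

  Suffix-total : {x y w : Word k} → Suffix y x → Suffix w x → Suffix y w ⊎ Suffix w y
  Suffix-total ([]    , refl) (q     , e) = inj₂ (q , e)
  Suffix-total (c ∷ p , refl) ([]    , e) = inj₁ (c ∷ p , sym e)
  Suffix-total (c ∷ p , refl) (d ∷ q , e) = Suffix-total (p , refl) (q , ∷-injectiveʳ e)

  Suffix-singleton : {w : Word k} {c : Fin k} → w ≢ [] → Suffix w [ c ] → w ≡ [ c ]
  Suffix-singleton w≢[] ([]    , e) = e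
  Suffix-singleton w≢[] (d ∷ p , e) = ⊥-elim (w≢[] (++-conicalʳ p _ (∷-injectiveʳ e)))

module _ {k : ℕ} (T : InvAntimorphism k) where

  Θ-[] : Θ T [] ≡ []
  Θ-[] = sym (++-cancelˡ (Θ T []) [] (Θ T []) (trans (++-identityʳ _) (anti T [] [])))

  Θ-≢[] : {x : Word k} → x ≢ [] → Θ T x ≢ []
  Θ-≢[] {x} x≢[] Θx≡[] = x≢[] (trans (sym (involut T x)) (trans (cong (Θ T) Θx≡[]) Θ-[]))

  private
    length-Θ-≥ : (x : Word k) → length x ≤ length (Θ T x)
    length-Θ-≥ []      = z≤n
    length-Θ-≥ (c ∷ x) = begin
      suc (length x)                         ≡⟨ +-comm 1 (length x) ⟩
      length x + 1                           ≤⟨ +-mono-≤ (length-Θ-≥ x) (nonempty (Θ-≢[] {[ c ]} λ ())) ⟩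
      length (Θ T x) + length (Θ T [ c ])    ≡⟨ sym (length-++ (Θ T x)) ⟩
      length (Θ T x ++ Θ T [ c ])            ≡⟨ cong length (sym (anti T [ c ] x)) ⟩
      length (Θ T (c ∷ x))                   ∎
      where
      open ≤-Reasoning
      nonempty : {z : Word k} → z ≢ [] → 1 ≤ length z
      nonempty {[]}    z≢[] = ⊥-elim (z≢[] refl)
      nonempty {_ ∷ _} _    = s≤s z≤n

  length-Θ : (x : Word k) → length (Θ T x) ≡ length x
  length-Θ x = ≤-antisym (subst (λ y → length (Θ T x) ≤ length y) (involut T x) (length-Θ-≥ (Θ T x)))
                         (length-Θ-≥ x)

  Suffix⇒Prefix-Θ : {w y : Word k} → Suffix w y → Prefix (Θ T w) (Θ T y)
  Suffix⇒Prefix-Θ {w} (r , refl) = Θ T r , sym (anti T r w)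

  numPalFactors-positive : (v : Word k) → 1 ≤ numPalFactors T v
  numPalFactors-positive v = ∈⇒1≤length (Equivalence.to (deduplicate-∈⇔ _≟W_)
    (∈-filter⁺ (isPal? T) (Infix⇒∈-allFactors ([] , v , refl)) Θ-[]))

  numPalFactors-cong : {v v′ : Word k} → Infix v′ v →
    (∀ y → IsPal T y → Infix y v → Infix y v′) → numPalFactors T v ≡ numPalFactors T v′
  numPalFactors-cong {v} {v′} v′⊑v old = length-deduplicate-cong _≟W_ shrink grow
    where
    shrink : ∀ {y} → y ∈ filter (isPal? T) (allFactors v) → y ∈ filter (isPal? T) (allFactors v′)
    shrink {y} m with ∈-filter⁻ (isPal? T) m
    ... | y∈ , pal = ∈-filter⁺ (isPal? T) (Infix⇒∈-allFactors (old y pal (∈-allFactors⇒Infix y∈))) pal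
    grow : ∀ {y} → y ∈ filter (isPal? T) (allFactors v′) → y ∈ filter (isPal? T) (allFactors v)
    grow {y} m with ∈-filter⁻ (isPal? T) m
    ... | y∈ , pal = ∈-filter⁺ (isPal? T) (Infix⇒∈-allFactors (Infix-trans (∈-allFactors⇒Infix y∈) v′⊑v)) pal

  #γ-cong : {v v′ : Word k} → Infix v′ v →
    (∀ y → length y ≡ 1 → Infix y v → Infix y v′) → #γ T v ≡ #γ T v′
  #γ-cong {v} {v′} v′⊑v old =
    cong (λ bs → length (deduplicate samePair? (map (λ b → (b ∷ [] , Θ T (b ∷ []))) bs)))
      (filter-≐ _ _ ( Product.map₂ (Sum.map (shrink refl) (shrink (length-Θ _)))
                    , Product.map₂ (Sum.map grow grow))
                (allFin k))
    where
    shrink : ∀ {y} → length y ≡ 1 → y ∈ allFactors v → y ∈ allFactors v′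
    shrink |y|≡1 y∈ = Infix⇒∈-allFactors (old _ |y|≡1 (∈-allFactors⇒Infix y∈))
    grow : ∀ {y} → y ∈ allFactors v′ → y ∈ allFactors v
    grow y∈ = Infix⇒∈-allFactors (Infix-trans (∈-allFactors⇒Infix y∈) v′⊑v)

  RichFin-∷ʳ-adds-palindrome : {v : Word k} {a : Fin k} → RichFin T v → RichFin T (v ∷ʳ a) →
    #γ T (v ∷ʳ a) ≡ #γ T v → numPalFactors T (v ∷ʳ a) ≢ numPalFactors T v
  RichFin-∷ʳ-adds-palindrome {v} {a} rich rich∷ʳ same-γ same-pal =
    1+n≢n (sym (trans (sym rich) (trans (sym same-pal) (trans rich∷ʳ |v∷ʳa|+1∸g))))
    where
    L = length v
    g = #γ T v
    g≤1+L : g ≤ suc L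
    g≤1+L = <⇒≤ (m∸n≢0⇒n<m (n>0⇒n≢0 (subst (1 ≤_) rich (numPalFactors-positive v))))
    |v∷ʳa|+1∸g : suc (length (v ∷ʳ a)) ∸ #γ T (v ∷ʳ a) ≡ suc (suc L ∸ g)
    |v∷ʳa|+1∸g = trans (cong₂ (λ n m → suc n ∸ m) (length-++-comm v [ a ]) same-γ)
                       (+-∸-assoc 1 g≤1+L)

  module _ {v w : Word k} {a : Fin k} (w≢[] : w ≢ []) (|w|< : length w < length (v ∷ʳ a))
           (w-prefix : Prefix w (v ∷ʳ a)) (w-suffix : Suffix w (v ∷ʳ a))
           (no-Θw : ¬ Infix (Θ T w) (v ∷ʳ a)) where

    private
      w⊑v : Infix w v
      w⊑v = Prefix⇒Infix (Prefix-∷ʳ |w|< w-prefix)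

      suffix-of-w⊑v : {y : Word k} → Suffix y w → Infix y v
      suffix-of-w⊑v y≼w = Infix-trans (Suffix⇒Infix y≼w) w⊑v

    palindromes-⊑-init : ∀ y → IsPal T y → Infix y (v ∷ʳ a) → Infix y v
    palindromes-⊑-init y pal y⊑ with Infix-∷ʳ y⊑
    ... | inj₁ y⊑v = y⊑v
    ... | inj₂ y≼ with Suffix-total y≼ w-suffix
    ...   | inj₁ y≼w = suffix-of-w⊑v y≼w
    ...   | inj₂ w≼y = ⊥-elim (no-Θw (Infix-trans (Prefix⇒Infix Θw≤y) y⊑))
      where
      Θw≤y : Prefix (Θ T w) y
      Θw≤y = subst (Prefix (Θ T w)) pal (Suffix⇒Prefix-Θ w≼y)

    letters-⊑-init : ∀ y → length y ≡ 1 → Infix y (v ∷ʳ a) → Infix y v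
    letters-⊑-init (c ∷ []) _ y⊑ with Infix-∷ʳ y⊑
    ... | inj₁ y⊑v = y⊑v
    ... | inj₂ y≼ with Suffix-total y≼ w-suffix
    ...   | inj₁ y≼w = suffix-of-w⊑v y≼w
    ...   | inj₂ w≼y = suffix-of-w⊑v ([] , sym (Suffix-singleton w≢[] w≼y))

    RichFin-∷ʳ-no-Θ-free-return : RichFin T v → RichFin T (v ∷ʳ a) → ⊥
    RichFin-∷ʳ-no-Θ-free-return rich rich∷ʳ =
      RichFin-∷ʳ-adds-palindrome {v} {a} rich rich∷ʳ
        (#γ-cong v⊑v∷ʳa letters-⊑-init) (numPalFactors-cong v⊑v∷ʳa palindromes-⊑-init)
      where
      v⊑v∷ʳa : Infix v (v ∷ʳ a)
      v⊑v∷ʳa = [] , [ a ] , refl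

factorAt-suc : ∀ {k} (u : InfWord k) i n → factorAt u i (suc n) ≡ factorAt u i n ∷ʳ u (i + n)
factorAt-suc u i zero    = cong (λ j → [ u j ]) (sym (+-identityʳ i))
factorAt-suc u i (suc n) = cong (u i ∷_) (trans (factorAt-suc u (suc i) n)
  (cong (λ j → factorAt u (suc i) n ∷ʳ u j) (sym (+-suc i n))))

module _ {k : ℕ} {u : InfWord k} where

  Factor-∷ʳ : {v : Word k} {a : Fin k} → Factor (v ∷ʳ a) u → Factor v u
  Factor-∷ʳ {v} {a} (i , e) = i , proj₁ (∷ʳ-injective _ _ (begin
    factorAt u i (length v) ∷ʳ u (i + length v)   ≡⟨ sym (factorAt-suc u i (length v)) ⟩
    factorAt u i (suc (length v))                 ≡⟨ cong (factorAt u i) (sym (length-++-comm v [ a ])) ⟩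
    factorAt u i (length (v ∷ʳ a))                ≡⟨ e ⟩
    v ∷ʳ a                                        ∎))
    where open ≡-Reasoning

  Rich⇒RichFin : (T : InvAntimorphism k) → Rich T u → {v : Word k} → Factor v u → RichFin T v
  Rich⇒RichFin T rich {v} (i , e) = subst (RichFin T) e (rich i (length v))

  Rich⇒¬BadFactor : (T : InvAntimorphism k) → Rich T u → {w : Word k} → w ≢ [] → ¬ BadFactor u w (Θ T w)
  Rich⇒¬BadFactor T rich w≢[] (v , v-factor , |w|< , w-prefix , w-suffix , no-Θw) with initLast v
  ... | [] with () ← |w|<
  ... | v′ ∷ʳ′ a = RichFin-∷ʳ-no-Θ-free-return T w≢[] |w|< w-prefix w-suffix no-Θw
                     (Rich⇒RichFin T rich {v′} (Factor-∷ʳ v-factor)) (Rich⇒RichFin T rich {v′ ∷ʳ a} v-factor)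

corollary4p4 : {k : ℕ} (T : InvAntimorphism k) (u : InfWord k) →
    Rich T u → (w : Word k) → Factor w u → ¬ (w ≡ Θ T w) → Alternate T u w
corollary4p4 T u rich w _ w≢Θw =
    Rich⇒¬BadFactor T rich w≢[]
  , λ bad → Rich⇒¬BadFactor T rich (Θ-≢[] T w≢[]) (subst (BadFactor u (Θ T w)) (sym (involut T w)) bad)
  where
  w≢[] : w ≢ []
  w≢[] refl = w≢Θw (sym (Θ-[] T))
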